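{- Let $k\geq 2$ be a fixed integer. Almost all graphs have $k$-color connection number $k$; that is, the proportion of labeled simple graphs on the vertex set $\{1,\dots,n\}$ with $cc_{k}(G)=k$ tends to $1$ as $n\to\infty$.
   Context: All graphs are finite, simple and undirected. An edge-coloring (not necessarily proper) of a graph is $k$-color connecting if between every pair of distinct vertices there is a path whose edges use at least $k$ different colors. $cc_{k}(G)$ is the minimum number of colors of a $k$-color connecting edge-coloring of $G$ (undefined if none exists). -}

module Defs where

open import Data.Nat using (ℕ; zero; suc; _+_; _*_; _∸_; _^_; _≤_; _<_)
open import Data.Nat.Combinatorics using (_C_)
open import Data.Fin using (Fin)
open import Data.Bool using (Bool; true; false)
open import Data.List using (List; []; _∷_; length)
open import Data.List.Membership.Propositional using (_∈_)
open import Data.List.Relation.Unary.All using (All)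
open import Data.List.Relation.Unary.AllPairs using (AllPairs)
open import Data.List.Relation.Unary.Unique.Propositional using (Unique)
open import Data.Product using (Σ; ∃; ∃-syntax; _×_; _,_)
open import Relation.Binary.PropositionalEquality using (_≡_; _≢_)
open import Relation.Nullary using (¬_)

-- A labeled finite simple graph on the vertex set Fin n = {0,…,n-1}
-- (standing for {1,…,n}): symmetric, irreflexive adjacency.
record Graph (n : ℕ) : Set where
  field
    adj    : Fin n → Fin n → Bool
    sym    : ∀ u v → adj u v ≡ adj v u
    irrefl : ∀ u → adj u u ≡ false
open Graph public

Distinct : ∀ {n} → Graph n → Graph n → Set
Distinct {n} G H = ∃[ u ] ∃[ v ] adj G u v ≢ adj H u v

-- Edge-coloring of G with (at most) r colors: a symmetric assignment of a
-- color in Fin r to each pair of vertices (only values on edges matter).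
record EdgeColoring {n : ℕ} (G : Graph n) (r : ℕ) : Set where
  field
    col    : Fin n → Fin n → Fin r
    colSym : ∀ u v → col u v ≡ col v u
open EdgeColoring public

data Walk {n : ℕ} (G : Graph n) : Fin n → Fin n → Set where
  []  : ∀ {u} → Walk G u u
  _∷_ : ∀ {u w v} → adj G u w ≡ true → Walk G w v → Walk G u v

vertices : ∀ {n} {G : Graph n} {u v} → Walk G u v → List (Fin n)
vertices ([] {u}) = u ∷ []
vertices (_∷_ {u} e p) = u ∷ vertices p

edgeColors : ∀ {n} {G : Graph n} {r} → EdgeColoring G r →
             ∀ {u v} → Walk G u v → List (Fin r)
edgeColors c [] = []
edgeColors c (_∷_ {u} {w} e p) = col c u w ∷ edgeColors c p

IsPath : ∀ {n} {G : Graph n} {u v} → Walk G u v → Set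
IsPath p = Unique (vertices p)

UsesAtLeastColors : ∀ {n} {G : Graph n} {r} → EdgeColoring G r →
                    ℕ → ∀ {u v} → Walk G u v → Set
UsesAtLeastColors c k p =
  ∃[ L ] Unique L × length L ≡ k × All (λ x → x ∈ edgeColors c p) L

KColorConnecting : ∀ {n} {G : Graph n} {r} → ℕ → EdgeColoring G r → Set
KColorConnecting {n} {G} k c =
  ∀ (u v : Fin n) → u ≢ v →
    Σ (Walk G u v) λ p → IsPath p × UsesAtLeastColors c k p

HasKCC : ∀ {n} → ℕ → Graph n → ℕ → Set
HasKCC k G r = Σ (EdgeColoring G r) (KColorConnecting k)

ccIs : ∀ {n} → ℕ → Graph n → ℕ → Set
ccIs k G m = HasKCC k G m × (∀ r → r < m → ¬ HasKCC k G r)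

numGraphs : ℕ → ℕ
numGraphs n = 2 ^ (n C 2)

-- Labelled graphs on n vertices are bit strings of length n C 2, one bit per pair of vertices, so
-- proportions of graphs are counts of bit strings. Cut the vertices into B blocks of k + 1 consecutive
-- vertices and give the edge from the i-th to the (i + 1)-th vertex of a block colour i. For u ≠ v and
-- a block avoiding both, the path from u through the block to v shows all k colours as soon as its
-- k + 2 edges are present. Different blocks involve disjoint sets of pairs, so these events are
-- independent: u and v are linked by no block for at most a (1 - 2^-(k+2))^(B-2) fraction of the
-- graphs, and a union bound over the n² pairs with B of order n / (k + 1) leaves a vanishing fraction.
-- Fewer than k colours never suffice, since one path must already show k distinct colours.

module Submission where

open import Data.Bool using (Bool; true; false; not; _∧_; _∨_; if_then_else_; T)
open import Data.Bool.ListAction using (all; any)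
open import Data.Bool.Properties using (T-≡; ∧-comm; ∧-zeroʳ)
open import Data.Empty using (⊥-elim)
open import Data.Fin as Fin using (Fin; toℕ; fromℕ<)
open import Data.Fin.Properties using (toℕ-fromℕ<; toℕ-injective; toℕ<n; pigeonhole)
open import Data.List using (List; []; _∷_; _++_; length; map; lookup; applyUpTo; upTo; filter; allFin)
open import Data.List.Properties
  using ( length-++; length-map; length-applyUpTo; length-upTo; length-tabulate
        ; filter-accept; filter-reject; filter-all)
open import Data.List.Membership.Propositional using (_∈_)
open import Data.List.Membership.Propositional.Properties
  using (∈-lookup; ∈-map⁺; ∈-map⁻; ∈-filter⁻; ∈-upTo⁻; ∈-upTo⁺; ∈-applyUpTo⁺; ∈-++⁺ˡ)
open import Data.List.Relation.Unary.All as All using (All; []; _∷_; lookupAny)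
import Data.List.Relation.Unary.All.Properties as All
open import Data.List.Relation.Unary.Any using (Any; here; there)
open import Data.List.Relation.Unary.AllPairs as AllPairs using (AllPairs; []; _∷_)
import Data.List.Relation.Unary.AllPairs.Properties as AllPairs
open import Data.List.Relation.Unary.Unique.Propositional using (Unique)
import Data.List.Relation.Unary.Unique.Propositional.Properties as Unique
open import Data.Nat
  using ( ℕ; zero; suc; _+_; _*_; _∸_; _^_; _≤_; _<_; _≟_; _<?_; _⊔_; _⊓_; _/_; z≤n; s≤s
        ; NonZero; >-nonZero)
open import Data.Nat.Combinatorics using (_C_; nC1≡n; nCk+nC[k+1]≡[n+1]C[k+1])
open import Data.Nat.DivMod
  using ( _%_; _mod_; m<n⇒m%n≡m; [m+kn]%n≡m%n; m%n<n; m≡m%n+[m/n]*n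
        ; +-distrib-/-∣ʳ; m<n⇒m/n≡0; m*n/n≡m; m/n*n≤m; /-monoˡ-≤)
open import Data.Nat.Divisibility using (n∣m*n)
open import Data.Nat.Properties
open import Algebra.Properties.CommutativeSemigroup +-commutativeSemigroup using (interchange)
open import Data.Nat.Tactic.RingSolver using (solve-∀)
open import Data.List.Membership.DecPropositional _≟_ using (_∈?_)
open import Data.Product using (Σ; ∃-syntax; _×_; _,_; proj₁; proj₂; uncurry)
open import Data.Sum as Sum using (_⊎_; inj₁; inj₂)
open import Function using (_∘_; id; Equivalence)
open import Relation.Binary.Definitions using (tri<; tri≈; tri>)
open import Relation.Binary.PropositionalEquality
open import Relation.Nullary using (¬_; Dec; yes; no; ¬?)
open import Relation.Unary using (∁; Decidable; _⊆_)
open import Defs hiding (sym)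

none-satisfied : ∀ {A : Set} (p : A → Bool) {x xs} → x ∈ xs → T (not (any p xs)) → T (not (p x))
none-satisfied p {xs = y ∷ ys} (here refl) none with p y
... | true  = none
... | false = _
none-satisfied p {xs = y ∷ ys} (there x∈) none with p y
... | true  = ⊥-elim none
... | false = none-satisfied p x∈ none

some-satisfied : ∀ {A : Set} (p : A → Bool) xs → T (not (all (not ∘ p) xs)) → Any (T ∘ p) xs
some-satisfied p (x ∷ xs) some with p x in eq
... | true  = here (Equivalence.from T-≡ eq)
... | false = there (some-satisfied p xs some)

≢? : ∀ c → Decidable (_≢ c)
≢? c j = ¬? (j ≟ c)

without : ℕ → List ℕ → List ℕ
without c = filter (≢? c)

length-without : ∀ c {xs} → Unique xs → length xs ≤ suc (length (without c xs))
length-without c {[]}     []          = z≤n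
length-without c {x ∷ xs} (x∉ ∷ uniq) = by-cases (x ≟ c)
  where
  by-cases : Dec (x ≡ c) → length (x ∷ xs) ≤ suc (length (without c (x ∷ xs)))
  by-cases (yes refl) = ≤-reflexive (cong (suc ∘ length) (sym (begin
    without x (x ∷ xs) ≡⟨ filter-reject (≢? x) (λ x≢x → x≢x refl) ⟩
    without x xs       ≡⟨ filter-all (≢? x) (All.map (λ x≢y y≡x → x≢y (sym y≡x)) x∉) ⟩
    xs                 ∎)))
    where open ≡-Reasoning
  by-cases (no x≢c) = subst (λ ys → suc (length xs) ≤ suc (length ys))
                            (sym (filter-accept (≢? c) x≢c)) (s≤s (length-without c uniq))

allPairs-restrict : ∀ {A : Set} {P : A → Set} {R S : A → A → Set} →
                    (∀ {x y} → P x → P y → R x y → S x y) →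
                    ∀ {xs} → All P xs → AllPairs R xs → AllPairs S xs
allPairs-restrict f []         []         = []
allPairs-restrict f (px ∷ pxs) (rx ∷ rxs) =
  All.zipWith (λ (py , rxy) → f px py rxy) (pxs , rx) ∷ allPairs-restrict f pxs rxs

lookup-injective : ∀ {A : Set} {xs : List A} → Unique xs →
                   ∀ {i j} → lookup xs i ≡ lookup xs j → i ≡ j
lookup-injective (_ ∷ _)    {Fin.zero}  {Fin.zero}  _  = refl
lookup-injective (x∉ ∷ _)   {Fin.zero}  {Fin.suc j} eq = ⊥-elim (All.lookup x∉ (∈-lookup j) eq)
lookup-injective (x∉ ∷ _)   {Fin.suc i} {Fin.zero}  eq = ⊥-elim (All.lookup x∉ (∈-lookup i) (sym eq))
lookup-injective (_ ∷ uniq) {Fin.suc i} {Fin.suc j} eq = cong Fin.suc (lookup-injective uniq eq)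

unique⇒length≤ : ∀ {r} {xs : List (Fin r)} → Unique xs → length xs ≤ r
unique⇒length≤ {r} {xs} uniq with r <? length xs
... | no r≮ = ≮⇒≥ r≮
... | yes r<
  with i , j , i<j , eq ← pigeonhole r< (lookup xs)
  = ⊥-elim (<⇒≢ i<j (cong toℕ (lookup-injective uniq eq)))

-- Counting bit strings

Event : Set
Event = List Bool → Bool

bit : List Bool → ℕ → Bool
bit []      _       = false
bit (b ∷ _) zero    = b
bit (_ ∷ w) (suc p) = bit w p

count : ℕ → Event → ℕ
count zero    E = if E [] then 1 else 0
count (suc N) E = count N (E ∘ (true ∷_)) + count N (E ∘ (false ∷_))

satisfying : ℕ → Event → List (List Bool)
satisfying zero    E = if E [] then [] ∷ [] else []
satisfying (suc N) E =
  map (true ∷_) (satisfying N (E ∘ (true ∷_))) ++ map (false ∷_) (satisfying N (E ∘ (false ∷_)))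

length-satisfying : ∀ N E → length (satisfying N E) ≡ count N E
length-satisfying zero E with E []
... | true  = refl
... | false = refl
length-satisfying (suc N) E = begin
  length (map (true ∷_) St ++ map (false ∷_) Sf)      ≡⟨ length-++ (map (true ∷_) St) ⟩
  length (map (true ∷_) St) + length (map (false ∷_) Sf)
    ≡⟨ cong₂ _+_ (length-map _ St) (length-map _ Sf) ⟩
  length St + length Sf
    ≡⟨ cong₂ _+_ (length-satisfying N (E ∘ (true ∷_))) (length-satisfying N (E ∘ (false ∷_))) ⟩
  count (suc N) E                                      ∎
  where
  open ≡-Reasoning
  St Sf : List (List Bool)
  St = satisfying N (E ∘ (true ∷_))
  Sf = satisfying N (E ∘ (false ∷_))

satisfying-sound : ∀ N E → All (T ∘ E) (satisfying N E)
satisfying-sound zero E with E [] in eq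
... | true  = Equivalence.from T-≡ eq ∷ []
... | false = []
satisfying-sound (suc N) E = All.++⁺ (All.map⁺ (satisfying-sound N (E ∘ (true ∷_))))
                                     (All.map⁺ (satisfying-sound N (E ∘ (false ∷_))))

DifferBelow : ℕ → List Bool → List Bool → Set
DifferBelow N w w' = ∃[ p ] p < N × bit w p ≢ bit w' p

satisfying-distinct : ∀ N E → AllPairs (DifferBelow N) (satisfying N E)
satisfying-distinct zero E with E []
... | true  = [] ∷ []
... | false = []
satisfying-distinct (suc N) E = AllPairs.++⁺ (shifted (E ∘ (true ∷_))) (shifted (E ∘ (false ∷_)))
  (All.map⁺ (All.universal (λ _ → All.map⁺ (All.universal (λ _ → zero , s≤s z≤n , λ ()) _)) _))
  where
  shifted : ∀ {b} F → AllPairs (DifferBelow (suc N)) (map (b ∷_) (satisfying N F))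
  shifted F = AllPairs.map⁺ (AllPairs.map (λ (p , p<N , ≢) → suc p , s≤s p<N , ≢)
                                          (satisfying-distinct N F))

count-cong : ∀ N {E F} → (∀ w → E w ≡ F w) → count N E ≡ count N F
count-cong zero    E≡F rewrite E≡F [] = refl
count-cong (suc N) E≡F =
  cong₂ _+_ (count-cong N (E≡F ∘ (true ∷_))) (count-cong N (E≡F ∘ (false ∷_)))

count-false : ∀ N → count N (λ _ → false) ≡ 0
count-false zero    = refl
count-false (suc N) = cong₂ _+_ (count-false N) (count-false N)

count-true : ∀ N → count N (λ _ → true) ≡ 2 ^ N
count-true zero    = refl
count-true (suc N) = cong₂ _+_ (count-true N) (trans (count-true N) (sym (+-identityʳ _)))

count-complement : ∀ N E → count N E + count N (not ∘ E) ≡ 2 ^ N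
count-complement zero E with E []
... | true  = refl
... | false = refl
count-complement (suc N) E = begin
  (count N Et + count N Ef) + (count N (not ∘ Et) + count N (not ∘ Ef))
    ≡⟨ interchange (count N Et) (count N Ef) _ _ ⟩
  (count N Et + count N (not ∘ Et)) + (count N Ef + count N (not ∘ Ef))
    ≡⟨ cong₂ _+_ (count-complement N Et) (trans (count-complement N Ef) (sym (+-identityʳ _))) ⟩
  2 ^ suc N ∎
  where
  open ≡-Reasoning
  Et Ef : Event
  Et = E ∘ (true ∷_)
  Ef = E ∘ (false ∷_)

count-∨ : ∀ N E F → count N (λ w → E w ∨ F w) ≤ count N E + count N F
count-∨ zero E F with E [] | F []
... | true  | true  = s≤s z≤n
... | true  | false = s≤s z≤n
... | false | _     = ≤-refl
count-∨ (suc N) E F = begin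
  count N (λ w → E (true ∷ w) ∨ F (true ∷ w)) + count N (λ w → E (false ∷ w) ∨ F (false ∷ w))
    ≤⟨ +-mono-≤ (count-∨ N (tail true E) (tail true F)) (count-∨ N (tail false E) (tail false F)) ⟩
  (c true E + c true F) + (c false E + c false F)
    ≡⟨ interchange (c true E) (c true F) (c false E) (c false F) ⟩
  count (suc N) E + count (suc N) F ∎
  where
  open ≤-Reasoning
  tail : Bool → Event → Event
  tail b G = G ∘ (b ∷_)
  c : Bool → Event → ℕ
  c b G = count N (tail b G)

count-any : ∀ {X : Set} N {a b} (E : X → Event) xs → All (λ x → count N (E x) * a ≤ b) xs →
            count N (λ w → any (λ x → E x w) xs) * a ≤ length xs * b
count-any N {a} E []       []         = ≤-reflexive (cong (_* a) (count-false N))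
count-any N {a} {b} E (x ∷ xs) (bx ∷ bxs) = begin
  count N (λ w → E x w ∨ any (λ y → E y w) xs) * a
    ≤⟨ *-monoˡ-≤ a (count-∨ N (E x) _) ⟩
  (count N (E x) + count N (λ w → any (λ y → E y w) xs)) * a
    ≡⟨ *-distribʳ-+ a (count N (E x)) _ ⟩
  count N (E x) * a + count N (λ w → any (λ y → E y w) xs) * a
    ≤⟨ +-mono-≤ bx (count-any N E xs bxs) ⟩
  b + length xs * b ∎
  where open ≤-Reasoning

-- Independent events

DependsOnly : (ℕ → Set) → Event → Set
DependsOnly S E = ∀ w w' → (∀ {p} → S p → bit w p ≡ bit w' p) → E w ≡ E w'

dependsOnly-mono : ∀ {S S' E} → S ⊆ S' → DependsOnly S E → DependsOnly S' E
dependsOnly-mono S⊆S' dE w w' agree = dE w w' (agree ∘ S⊆S')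

dependsOnly-tail : ∀ {S E} b → DependsOnly S E → DependsOnly (S ∘ suc) (E ∘ (b ∷_))
dependsOnly-tail b dE w w' agree = dE (b ∷ w) (b ∷ w') λ { {zero} _ → refl ; {suc p} s → agree s }

ignoresHead : ∀ {S E} → ¬ S 0 → DependsOnly S E → ∀ w → E (true ∷ w) ≡ E (false ∷ w)
ignoresHead ¬S0 dE w = dE _ _ λ { {zero} s → ⊥-elim (¬S0 s) ; {suc p} _ → refl }

private
  count-∧-headFree : ∀ N {E F} → (∀ w → F (true ∷ w) ≡ F (false ∷ w)) →
    (∀ b → count N (λ w → E (b ∷ w) ∧ F (true ∷ w)) * 2 ^ N ≡
           count N (E ∘ (b ∷_)) * count N (F ∘ (true ∷_))) →
    count (suc N) (λ w → E w ∧ F w) * 2 ^ suc N ≡ count (suc N) E * count (suc N) F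
  count-∧-headFree N {E} {F} Fhead IH = begin
    (x true + count N (λ w → E (false ∷ w) ∧ F (false ∷ w))) * (2 * P)
      ≡⟨ cong (λ y → (x true + y) * (2 * P)) (count-cong N λ w → cong (E (false ∷ w) ∧_) (sym (Fhead w))) ⟩
    (x true + x false) * (2 * P)       ≡⟨ expand (x true) (x false) P ⟩
    2 * (x true * P + x false * P)     ≡⟨ cong₂ (λ u v → 2 * (u + v)) (IH true) (IH false) ⟩
    2 * (e true * f + e false * f)     ≡⟨ collect (e true) (e false) f ⟩
    count (suc N) E * (f + f)          ≡⟨ cong (λ y → count (suc N) E * (f + y)) (count-cong N Fhead) ⟩
    count (suc N) E * count (suc N) F  ∎
    where
    open ≡-Reasoning
    P f : ℕ
    P = 2 ^ N
    f = count N (F ∘ (true ∷_))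
    e : Bool → ℕ
    e b = count N (E ∘ (b ∷_))
    x : Bool → ℕ
    x b = count N (λ w → E (b ∷ w) ∧ F (true ∷ w))
    expand : ∀ x y P → (x + y) * (2 * P) ≡ 2 * (x * P + y * P)
    expand = solve-∀
    collect : ∀ a b c → 2 * (a * c + b * c) ≡ (a + b) * (c + c)
    collect = solve-∀

-- Split on the first bit: one of E and F ignores it, according as S 0 holds or not.
count-∧-independent : ∀ N {S E F} → Decidable S → DependsOnly S E → DependsOnly (∁ S) F →
                      count N (λ w → E w ∧ F w) * 2 ^ N ≡ count N E * count N F
count-∧-independent zero {E = E} {F} _ _ _ with E [] | F []
... | true  | true  = refl
... | true  | false = refl
... | false | _     = refl
count-∧-independent (suc N) {S} {E} {F} S? dE dF with S? 0
... | yes S0 = count-∧-headFree N {E} {F} (ignoresHead (λ ¬S0 → ¬S0 S0) dF)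
  (λ b → count-∧-independent N (S? ∘ suc) (dependsOnly-tail b dE) (dependsOnly-tail true dF))
... | no ¬S0 = begin
  count (suc N) (λ w → E w ∧ F w) * 2 ^ suc N
    ≡⟨ cong (_* 2 ^ suc N) (count-cong (suc N) λ w → ∧-comm (E w) (F w)) ⟩
  count (suc N) (λ w → F w ∧ E w) * 2 ^ suc N
    ≡⟨ count-∧-headFree N {F} {E} (ignoresHead ¬S0 dE) IH-swapped ⟩
  count (suc N) F * count (suc N) E
    ≡⟨ *-comm (count (suc N) F) _ ⟩
  count (suc N) E * count (suc N) F ∎
  where
  open ≡-Reasoning
  IH-swapped : ∀ b → count N (λ w → F (b ∷ w) ∧ E (true ∷ w)) * 2 ^ N ≡
                     count N (F ∘ (b ∷_)) * count N (E ∘ (true ∷_))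
  IH-swapped b = begin
    count N (λ w → F (b ∷ w) ∧ E (true ∷ w)) * 2 ^ N
      ≡⟨ cong (_* 2 ^ N) (count-cong N λ w → ∧-comm (F (b ∷ w)) _) ⟩
    count N (λ w → E (true ∷ w) ∧ F (b ∷ w)) * 2 ^ N
      ≡⟨ count-∧-independent N (S? ∘ suc) (dependsOnly-tail true dE) (dependsOnly-tail b dF) ⟩
    count N (E ∘ (true ∷_)) * count N (F ∘ (b ∷_))
      ≡⟨ *-comm (count N (E ∘ (true ∷_))) _ ⟩
    count N (F ∘ (b ∷_)) * count N (E ∘ (true ∷_)) ∎

module _ {J : Set} (support : J → ℕ → Set) (support? : ∀ j → Decidable (support j))
         (E : J → Event) (E-dependsOnly : ∀ j → DependsOnly (support j) (E j)) where

  allOf : List J → Event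
  allOf js w = all (λ j → E j w) js

  allOf-dependsOnly : ∀ js → DependsOnly (λ p → Any (λ j → support j p) js) (allOf js)
  allOf-dependsOnly []       _ _ _     = refl
  allOf-dependsOnly (j ∷ js) w w' agree =
    cong₂ _∧_ (E-dependsOnly j w w' (agree ∘ here)) (allOf-dependsOnly js w w' (agree ∘ there))

  count-allOf-independent : ∀ N {a b} js → AllPairs (λ i j → support i ⊆ ∁ (support j)) js →
    All (λ j → count N (E j) * a ≤ b * 2 ^ N) js →
    count N (allOf js) * a ^ length js ≤ b ^ length js * 2 ^ N
  count-allOf-independent N [] [] [] =
    ≤-reflexive (trans (*-identityʳ _) (trans (count-true N) (sym (+-identityʳ _))))
  count-allOf-independent N {a} {b} (j ∷ js) (disj ∷ disjs) (bound ∷ bounds) =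
    *-cancelʳ-≤ _ _ P {{m^n≢0 2 N}} (begin
      x * (a * a ^ t) * P          ≡⟨ reassoc x (a * a ^ t) P ⟩
      x * P * (a * a ^ t)          ≡⟨ cong (_* (a * a ^ t)) independent ⟩
      count N (E j) * y * (a * a ^ t) ≡⟨ [m*n]*[o*p]≡[m*o]*[n*p] (count N (E j)) y a (a ^ t) ⟩
      count N (E j) * a * (y * a ^ t) ≤⟨ *-mono-≤ bound (count-allOf-independent N js disjs bounds) ⟩
      b * P * (b ^ t * P)          ≡⟨ [m*n]*[o*p]≡[m*o]*[n*p] b P (b ^ t) P ⟩
      b * b ^ t * (P * P)          ≡⟨ *-assoc (b * b ^ t) P P ⟨
      b * b ^ t * P * P            ∎)
    where
    open ≤-Reasoning
    P t x y : ℕ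
    P = 2 ^ N
    t = length js
    x = count N (allOf (j ∷ js))
    y = count N (allOf js)
    rest-outside : (λ p → Any (λ j' → support j' p) js) ⊆ ∁ (support j)
    rest-outside any s = let d , s' = lookupAny disj any in d s s'
    independent : x * P ≡ count N (E j) * y
    independent = count-∧-independent N (support? j) (E-dependsOnly j)
                    (dependsOnly-mono rest-outside (allOf-dependsOnly js))
    reassoc : ∀ x y z → x * y * z ≡ x * z * y
    reassoc = solve-∀

allSet : List ℕ → Event
allSet ps w = all (bit w) ps

allSet-dependsOnly : ∀ ps → DependsOnly (_∈ ps) (allSet ps)
allSet-dependsOnly []       _ _ _     = refl
allSet-dependsOnly (p ∷ ps) w w' agree =
  cong₂ _∧_ (agree (here refl)) (allSet-dependsOnly ps w w' (agree ∘ there))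

allSet-∷-∈ : ∀ {p ps} → p ∈ ps → ∀ w → bit w p ∧ allSet ps w ≡ allSet ps w
allSet-∷-∈ {p} {ps} p∈ps w with allSet ps w in eq
... | false = ∧-zeroʳ (bit w p)
... | true  = cong (_∧ true) (Equivalence.to T-≡ (All.lookup bits-set p∈ps))
  where
  bits-set : All (T ∘ bit w) ps
  bits-set = All.all⁺ (bit w) ps (Equivalence.from T-≡ eq)

count-bit : ∀ {N p} → p < N → count N (λ w → bit w p) * 2 ≡ 2 ^ N
count-bit {suc N} {zero} _ = begin
  (count N (λ _ → true) + count N (λ _ → false)) * 2
    ≡⟨ cong₂ (λ u v → (u + v) * 2) (count-true N) (count-false N) ⟩
  (2 ^ N + 0) * 2 ≡⟨ cong (_* 2) (+-identityʳ (2 ^ N)) ⟩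
  2 ^ N * 2       ≡⟨ *-comm (2 ^ N) 2 ⟩
  2 ^ suc N ∎
  where open ≡-Reasoning
count-bit {suc N} {suc p} (s≤s p<N) = begin
  (c + c) * 2     ≡⟨ *-distribʳ-+ 2 c c ⟩
  c * 2 + c * 2   ≡⟨ cong₂ _+_ (count-bit p<N) (trans (count-bit p<N) (sym (+-identityʳ _))) ⟩
  2 ^ suc N       ∎
  where
  open ≡-Reasoning
  c = count N (λ w → bit w p)

count-allSet : ∀ N ps → All (_< N) ps → 2 ^ N ≤ count N (allSet ps) * 2 ^ length ps
count-allSet N [] [] = ≤-reflexive (sym (trans (*-identityʳ _) (count-true N)))
count-allSet N (p ∷ ps) (p<N ∷ ps<N) with p ∈? ps
... | yes p∈ps = begin
  2 ^ N                                   ≤⟨ count-allSet N ps ps<N ⟩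
  count N (allSet ps) * 2 ^ length ps     ≤⟨ *-monoʳ-≤ (count N (allSet ps)) (m≤n*m (2 ^ length ps) 2) ⟩
  count N (allSet ps) * 2 ^ suc (length ps)
    ≡⟨ cong (_* 2 ^ suc (length ps)) (count-cong N (sym ∘ allSet-∷-∈ p∈ps)) ⟩
  count N (allSet (p ∷ ps)) * 2 ^ suc (length ps) ∎
  where open ≤-Reasoning
... | no p∉ps = *-cancelʳ-≤ _ _ P {{m^n≢0 2 N}} (begin
  P * P                            ≤⟨ *-monoʳ-≤ P (count-allSet N ps ps<N) ⟩
  P * (y * 2 ^ t)                  ≡⟨ cong (_* (y * 2 ^ t)) (count-bit p<N) ⟨
  count N (λ w → bit w p) * 2 * (y * 2 ^ t)
    ≡⟨ [m*n]*[o*p]≡[m*o]*[n*p] (count N (λ w → bit w p)) 2 y (2 ^ t) ⟩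
  count N (λ w → bit w p) * y * 2 ^ suc t ≡⟨ cong (_* 2 ^ suc t) independent ⟨
  x * P * 2 ^ suc t                ≡⟨ reassoc x P (2 ^ suc t) ⟩
  x * 2 ^ suc t * P                ∎)
  where
  open ≤-Reasoning
  P t x y : ℕ
  P = 2 ^ N
  t = length ps
  x = count N (allSet (p ∷ ps))
  y = count N (allSet ps)
  independent : x * P ≡ count N (λ w → bit w p) * y
  independent = count-∧-independent N (_≟ p) (λ w w' agree → agree refl)
    (dependsOnly-mono (λ { q∈ps refl → p∉ps q∈ps }) (allSet-dependsOnly ps))
  reassoc : ∀ x y z → x * y * z ≡ x * z * y
  reassoc = solve-∀

count-not-allSet : ∀ N ps → All (_< N) ps →
                   count N (not ∘ allSet ps) * 2 ^ length ps ≤ (2 ^ length ps ∸ 1) * 2 ^ N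
count-not-allSet N ps ps<N = complement-bound {d = count N (not ∘ allSet ps)} {A = 2 ^ length ps}
                                              (count-complement N (allSet ps)) (count-allSet N ps ps<N)
  where
  complement-bound : ∀ {c d P A} → c + d ≡ P → P ≤ c * A → d * A ≤ (A ∸ 1) * P
  complement-bound {c} {d} {P} {A} c+d≡P P≤cA = begin
    d * A         ≤⟨ m+n≤o⇒m≤o∸n (d * A) (begin
                       d * A + P     ≤⟨ +-monoʳ-≤ (d * A) P≤cA ⟩
                       d * A + c * A ≡⟨ *-distribʳ-+ A d c ⟨
                       (d + c) * A   ≡⟨ cong (_* A) (trans (+-comm d c) c+d≡P) ⟩
                       P * A         ≡⟨ *-comm P A ⟩
                       A * P         ∎) ⟩
    A * P ∸ P     ≡⟨ cong (A * P ∸_) (*-identityˡ P) ⟨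
    A * P ∸ 1 * P ≡⟨ *-distribʳ-∸ P A 1 ⟨
    (A ∸ 1) * P   ∎
    where open ≤-Reasoning

-- Graphs as bit strings

tri : ℕ → ℕ
tri zero    = 0
tri (suc n) = tri n + n

tri≡C2 : ∀ n → tri n ≡ n C 2
tri≡C2 zero    = refl
tri≡C2 (suc n) = begin
  tri n + n       ≡⟨ cong (_+ n) (tri≡C2 n) ⟩
  n C 2 + n       ≡⟨ +-comm (n C 2) n ⟩
  n + n C 2       ≡⟨ cong (_+ n C 2) (nC1≡n n) ⟨
  n C 1 + n C 2   ≡⟨ nCk+nC[k+1]≡[n+1]C[k+1] n 1 ⟩
  suc n C 2       ∎
  where open ≡-Reasoning

tri-mono-≤ : ∀ {b c} → b ≤ c → tri b ≤ tri c
tri-mono-≤ {c = zero}  z≤n = ≤-refl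
tri-mono-≤ {b} {suc c} b≤c with m≤n⇒m<n∨m≡n b≤c
... | inj₁ (s≤s b≤c') = ≤-trans (tri-mono-≤ b≤c') (m≤m+n (tri c) c)
... | inj₂ refl       = ≤-refl

tri+<tri : ∀ {a b c} → a < b → b < c → tri b + a < tri c
tri+<tri a<b b<c = <-≤-trans (+-monoʳ-< _ a<b) (tri-mono-≤ b<c)

tri+-injective : ∀ {a b a' b'} → a < b → a' < b' → tri b + a ≡ tri b' + a' → a ≡ a' × b ≡ b'
tri+-injective {a} {b} {a'} {b'} a<b a'<b' eq with <-cmp b b'
... | tri< b<b' _ _ = ⊥-elim (<-irrefl eq (<-≤-trans (tri+<tri a<b b<b') (m≤m+n _ a')))
... | tri> _ _ b'<b = ⊥-elim (<-irrefl (sym eq) (<-≤-trans (tri+<tri a'<b' b'<b) (m≤m+n _ a)))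
... | tri≈ _ refl _ = +-cancelˡ-≡ (tri b) a a' eq , refl

tri+-surjective : ∀ {n p} → p < tri n → ∃[ a ] ∃[ b ] a < b × b < n × tri b + a ≡ p
tri+-surjective {suc n} {p} p<tri with p <? tri n
... | yes p<tri' = let a , b , a<b , b<n , eq = tri+-surjective p<tri' in a , b , a<b , m<n⇒m<1+n b<n , eq
... | no p≮tri' =
  p ∸ tri n , n , +-cancelˡ-< (tri n) _ _ (subst (_< tri n + n) (sym eq) p<tri) , n<1+n n , eq
  where
  eq : tri n + (p ∸ tri n) ≡ p
  eq = m+[n∸m]≡n (≮⇒≥ p≮tri')

-- The pair {x, y} with x < y sits at bit tri y + x; for y < n these are exactly the bits below
-- tri n = n C 2.
pairIndex : ℕ → ℕ → ℕ
pairIndex x y = tri (x ⊔ y) + x ⊓ y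

pairIndex-comm : ∀ x y → pairIndex x y ≡ pairIndex y x
pairIndex-comm x y = cong₂ (λ a b → tri a + b) (⊔-comm x y) (⊓-comm x y)

pairIndex-< : ∀ {a b} → a < b → pairIndex a b ≡ tri b + a
pairIndex-< a<b = cong₂ (λ c d → tri c + d) (m≤n⇒m⊔n≡n (<⇒≤ a<b)) (m≤n⇒m⊓n≡m (<⇒≤ a<b))

⊓<⊔ : ∀ {x y} → x ≢ y → x ⊓ y < x ⊔ y
⊓<⊔ {x} {y} x≢y with ≤-total x y
... | inj₁ x≤y = subst₂ _<_ (sym (m≤n⇒m⊓n≡m x≤y)) (sym (m≤n⇒m⊔n≡n x≤y)) (≤∧≢⇒< x≤y x≢y)
... | inj₂ y≤x = subst₂ _<_ (sym (m≥n⇒m⊓n≡n y≤x)) (sym (m≥n⇒m⊔n≡m y≤x))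
                         (≤∧≢⇒< y≤x (x≢y ∘ sym))

pairIndex<tri : ∀ {n x y} → x < n → y < n → x ≢ y → pairIndex x y < tri n
pairIndex<tri x<n y<n x≢y = tri+<tri (⊓<⊔ x≢y) (⊔-pres-<m x<n y<n)

pairIndex-injective : ∀ {x y x' y'} → x ≢ y → x' ≢ y' →
                      pairIndex x y ≡ pairIndex x' y' → x ≡ x' ⊎ x ≡ y'
pairIndex-injective {x} {y} {x'} {y'} x≢y x'≢y' eq
  with ⊓≡ , ⊔≡ ← tri+-injective (⊓<⊔ x≢y) (⊓<⊔ x'≢y') eq
  = Sum.[ (λ x≤y → via (trans (sym (m≤n⇒m⊓n≡m x≤y)) ⊓≡) (⊓-sel x' y'))
        , (λ y≤x → via (trans (sym (m≥n⇒m⊔n≡m y≤x)) ⊔≡) (⊔-sel x' y')) ]′ (≤-total x y)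
  where
  via : ∀ {z} → x ≡ z → z ≡ x' ⊎ z ≡ y' → x ≡ x' ⊎ x ≡ y'
  via x≡z = Sum.map (trans x≡z) (trans x≡z)

edgeBit : List Bool → ℕ → ℕ → Bool
edgeBit w x y with x ≟ y
... | yes _ = false
... | no  _ = bit w (pairIndex x y)

edgeBit-comm : ∀ w x y → edgeBit w x y ≡ edgeBit w y x
edgeBit-comm w x y with x ≟ y | y ≟ x
... | yes _   | yes _   = refl
... | yes x≡y | no y≢x  = ⊥-elim (y≢x (sym x≡y))
... | no x≢y  | yes y≡x = ⊥-elim (x≢y (sym y≡x))
... | no _    | no _    = cong (bit w) (pairIndex-comm x y)

edgeBit-diag : ∀ w x → edgeBit w x x ≡ false
edgeBit-diag w x with x ≟ x
... | yes _   = refl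
... | no x≢x  = ⊥-elim (x≢x refl)

edgeBit-≢ : ∀ {w x y} → x ≢ y → edgeBit w x y ≡ bit w (pairIndex x y)
edgeBit-≢ {w} {x} {y} x≢y with x ≟ y
... | yes x≡y = ⊥-elim (x≢y x≡y)
... | no _    = refl

toGraph : ∀ n → List Bool → Graph n
toGraph n w = record
  { adj    = λ u v → edgeBit w (toℕ u) (toℕ v)
  ; sym    = λ u v → edgeBit-comm w (toℕ u) (toℕ v)
  ; irrefl = λ u → edgeBit-diag w (toℕ u)
  }

toGraph-adj : ∀ {n w} {u v : Fin n} {x y} → toℕ u ≡ x → toℕ v ≡ y → x ≢ y →
              adj (toGraph n w) u v ≡ bit w (pairIndex x y)
toGraph-adj refl refl = edgeBit-≢

toGraph-distinct : ∀ {n w w'} → DifferBelow (tri n) w w' → Distinct (toGraph n w) (toGraph n w')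
toGraph-distinct {n} {w} {w'} (p , p<tri , differ)
  with a , b , a<b , b<n , eq ← tri+-surjective p<tri
  = u , v , λ same → differ (trans (sym (at-p w)) (trans same (at-p w')))
  where
  u v : Fin n
  u = fromℕ< (<-trans a<b b<n)
  v = fromℕ< b<n
  at-p : ∀ x → adj (toGraph n x) u v ≡ bit x p
  at-p x = trans (toGraph-adj (toℕ-fromℕ< _) (toℕ-fromℕ< b<n) (<⇒≢ a<b))
                 (cong (bit x) (trans (pairIndex-< a<b) eq))

module _ {n} {G : Graph n} where

  AdjacentUpTo : (ℕ → Fin n) → ℕ → Set
  AdjacentUpTo f d = ∀ {i} → i < d → adj G (f i) (f (suc i)) ≡ true

  walkAlong : ∀ f d → AdjacentUpTo f d → Walk G (f 0) (f d)
  walkAlong f zero    _     = []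
  walkAlong f (suc d) edges = edges (s≤s z≤n) ∷ walkAlong (f ∘ suc) d (λ i<d → edges (s≤s i<d))

  _▷_ : ∀ {u w v} → Walk G u w → adj G w v ≡ true → Walk G u v
  []      ▷ e = e ∷ []
  (e' ∷ p) ▷ e = e' ∷ (p ▷ e)

  vertices-walkAlong : ∀ f d (edges : AdjacentUpTo f d) →
                       vertices (walkAlong f d edges) ≡ applyUpTo f (suc d)
  vertices-walkAlong f zero    _     = refl
  vertices-walkAlong f (suc d) edges =
    cong (f 0 ∷_) (vertices-walkAlong (f ∘ suc) d (λ i<d → edges (s≤s i<d)))

  vertices-▷ : ∀ {u w v} (p : Walk G u w) (e : adj G w v ≡ true) →
               vertices (p ▷ e) ≡ vertices p ++ v ∷ []
  vertices-▷ []       e = refl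
  vertices-▷ (e' ∷ p) e = cong (_ ∷_) (vertices-▷ p e)

  module _ {r} (c : EdgeColoring G r) where

    edgeColors-walkAlong : ∀ f d (edges : AdjacentUpTo f d) →
                           edgeColors c (walkAlong f d edges) ≡ applyUpTo (λ i → col c (f i) (f (suc i))) d
    edgeColors-walkAlong f zero    _     = refl
    edgeColors-walkAlong f (suc d) edges =
      cong (_ ∷_) (edgeColors-walkAlong (f ∘ suc) d (λ i<d → edges (s≤s i<d)))

    edgeColors-▷ : ∀ {u w v} (p : Walk G u w) (e : adj G w v ≡ true) →
                   edgeColors c (p ▷ e) ≡ edgeColors c p ++ col c w v ∷ []
    edgeColors-▷ []       e = refl
    edgeColors-▷ (e' ∷ p) e = cong (_ ∷_) (edgeColors-▷ p e)

hasKCC⇒k≤r : ∀ {n k r} {G : Graph n} → 2 ≤ n → HasKCC k G r → k ≤ r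
hasKCC⇒k≤r {suc (suc _)} (s≤s (s≤s _)) (_ , connecting)
  with _ , _ , _ , uniq , length≡k , _ ← connecting Fin.zero (Fin.suc Fin.zero) (λ ())
  = subst (_≤ _) length≡k (unique⇒length≤ uniq)

proportion-bound : ∀ {X Y P A Z m} .{{_ : NonZero A}} → X + Y ≡ P → X * A ≤ Z * P → m * Z ≤ A →
                   (m ∸ 1) * P ≤ m * Y
proportion-bound {X} {Y} {P} {A} {Z} {m} X+Y≡P XA≤ZP mZ≤A = begin
  (m ∸ 1) * P   ≡⟨ *-distribʳ-∸ P m 1 ⟩
  m * P ∸ 1 * P ≡⟨ cong (m * P ∸_) (*-identityˡ P) ⟩
  m * P ∸ P     ≤⟨ ∸-monoʳ-≤ (m * P) mX≤P ⟩
  m * P ∸ m * X ≡⟨ *-distribˡ-∸ m P X ⟨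
  m * (P ∸ X)   ≡⟨ cong (λ Q → m * (Q ∸ X)) X+Y≡P ⟨
  m * (X + Y ∸ X) ≡⟨ cong (m *_) (m+n∸m≡n X Y) ⟩
  m * Y         ∎
  where
  open ≤-Reasoning
  mX≤P : m * X ≤ P
  mX≤P = *-cancelʳ-≤ (m * X) P A (begin
    m * X * A   ≡⟨ *-assoc m X A ⟩
    m * (X * A) ≤⟨ *-monoʳ-≤ m XA≤ZP ⟩
    m * (Z * P) ≡⟨ *-assoc m Z P ⟨
    m * Z * P   ≤⟨ *-monoˡ-≤ P mZ≤A ⟩
    A * P       ≡⟨ *-comm A P ⟩
    P * A       ∎)

fewer-factors : ∀ {x P A β T L} .{{_ : NonZero A}} → β ≤ A → T ≤ L →
                x * A ^ L ≤ β ^ L * P → x * A ^ T ≤ β ^ T * P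
fewer-factors {x} {P} {A} {β} {T} β≤A T≤L bound
  with d , refl ← m≤n⇒∃[o]m+o≡n T≤L
  = *-cancelʳ-≤ _ _ (A ^ d) {{m^n≢0 A d}} (begin
  x * A ^ T * A ^ d     ≡⟨ *-assoc x (A ^ T) (A ^ d) ⟩
  x * (A ^ T * A ^ d)   ≡⟨ cong (x *_) (^-distribˡ-+-* A T d) ⟨
  x * A ^ (T + d)       ≤⟨ bound ⟩
  β ^ (T + d) * P       ≡⟨ cong (_* P) (^-distribˡ-+-* β T d) ⟩
  β ^ T * β ^ d * P     ≤⟨ *-monoˡ-≤ P (*-monoʳ-≤ (β ^ T) (^-monoˡ-≤ d β≤A)) ⟩
  β ^ T * A ^ d * P     ≡⟨ reorder (β ^ T) (A ^ d) P ⟩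
  β ^ T * P * A ^ d     ∎)
  where
  open ≤-Reasoning
  reorder : ∀ x y z → x * y * z ≡ x * z * y
  reorder = solve-∀

-- (1 + 1/b)^r ≥ 1 + r/b with the denominators cleared
bernoulli : ∀ b r → (b + r) * b ^ r ≤ b * suc b ^ r
bernoulli b zero    = ≤-reflexive (cong (_* 1) (+-identityʳ b))
bernoulli b (suc r) = begin
  (b + suc r) * (b * b ^ r)               ≤⟨ m≤m+n _ (r * b ^ r) ⟩
  (b + suc r) * (b * b ^ r) + r * b ^ r   ≡⟨ expand b r (b ^ r) ⟩
  suc b * ((b + r) * b ^ r)               ≤⟨ *-monoʳ-≤ (suc b) (bernoulli b r) ⟩
  suc b * (b * suc b ^ r)                 ≡⟨ *-comm-middle b (suc b) (suc b ^ r) ⟩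
  b * (suc b * suc b ^ r)                 ∎
  where
  open ≤-Reasoning
  expand : ∀ b r x → (b + suc r) * (b * x) + r * x ≡ suc b * ((b + r) * x)
  expand = solve-∀
  *-comm-middle : ∀ x y z → y * (x * z) ≡ x * (y * z)
  *-comm-middle = solve-∀

cubic-below-exponential : ∀ β c r .{{_ : NonZero β}} → c * β ^ 3 ≤ r →
                          c * (r * r) * β ^ (r * 3) ≤ suc β ^ (r * 3)
cubic-below-exponential β c r c*β³≤r = *-cancelʳ-≤ _ _ (β ^ 3) {{m^n≢0 β 3}} (begin
  c * (r * r) * β ^ (r * 3) * β ^ 3        ≡⟨ cong (λ x → c * (r * r) * x * β ^ 3) (^-*-assoc β r 3) ⟨
  c * (r * r) * (β ^ r) ^ 3 * β ^ 3        ≡⟨ regroup c r ((β ^ r) ^ 3) (β ^ 3) ⟩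
  c * β ^ 3 * (r * r * (β ^ r) ^ 3)        ≤⟨ *-monoˡ-≤ _ c*β³≤r ⟩
  r * (r * r * (β ^ r) ^ 3)                ≡⟨ cube r (β ^ r) ⟩
  (r * β ^ r) ^ 3                          ≤⟨ ^-monoˡ-≤ 3 r*β^r≤ ⟩
  (β * suc β ^ r) ^ 3                      ≡⟨ cube-distrib β (suc β ^ r) ⟩
  β ^ 3 * (suc β ^ r) ^ 3                  ≡⟨ cong (β ^ 3 *_) (^-*-assoc (suc β) r 3) ⟩
  β ^ 3 * suc β ^ (r * 3)                  ≡⟨ *-comm (β ^ 3) _ ⟩
  suc β ^ (r * 3) * β ^ 3                  ∎)
  where
  open ≤-Reasoning
  r*β^r≤ : r * β ^ r ≤ β * suc β ^ r
  r*β^r≤ = ≤-trans (*-monoˡ-≤ (β ^ r) (m≤n+m r β)) (bernoulli β r)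
  regroup : ∀ c r x y → c * (r * r) * x * y ≡ c * y * (r * r * x)
  regroup = solve-∀
  -- x ^ 3 is spelled out as x * (x * (x * 1)), which the ring solver accepts where it rejects the power.
  cube : ∀ r x → r * (r * r * (x * (x * (x * 1)))) ≡ r * x * (r * x * (r * x * 1))
  cube = solve-∀
  cube-distrib : ∀ x y → x * y * (x * y * (x * y * 1)) ≡ x * (x * (x * 1)) * (y * (y * (y * 1)))
  cube-distrib = solve-∀

-- With d = 4 (K + 1), r = n / d ≥ 2 and T = 3 r: (T + 2) (K + 1) ≤ r d ≤ n and n ≤ 2 d r, so
-- c n² β^T ≤ c (2 d)² r² β^(3 r), which cubic-below-exponential bounds once r ≥ c (2 d)² β³.
enough-blocks : ∀ K β c .{{_ : NonZero β}} →
  ∃[ N₀ ] ∀ n → N₀ ≤ n → ∃[ T ] (2 + T) * suc K ≤ n × c * (n * n * β ^ T) ≤ suc β ^ T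
enough-blocks K β c = (2 + R) * d , λ n N₀≤n →
  let 2+R≤r = many-blocks N₀≤n
  in n / d * 3 , blocks-fit (≤-trans (m≤m+n 2 R) 2+R≤r) ,
     growth (≤-trans (m≤n+m R 2) 2+R≤r) (n≤2dr n (≤-trans (s≤s z≤n) 2+R≤r))
  where
  d c′ R : ℕ
  d = 4 * suc K
  c′ = c * (2 * d) * (2 * d)
  R = c′ * β ^ 3
  many-blocks : ∀ {n} → (2 + R) * d ≤ n → 2 + R ≤ n / d
  many-blocks {n} N₀≤n = subst (_≤ n / d) (m*n/n≡m (2 + R) d) (/-monoˡ-≤ d N₀≤n)
  blocks-fit : ∀ {n} → 2 ≤ n / d → (2 + n / d * 3) * suc K ≤ n
  blocks-fit {n} 2≤r = begin
    (2 + r * 3) * suc K   ≤⟨ *-monoˡ-≤ (suc K) (+-monoˡ-≤ (r * 3) 2≤r) ⟩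
    (r + r * 3) * suc K   ≡⟨ regroup r (suc K) ⟩
    r * d                 ≤⟨ m/n*n≤m n d ⟩
    n                     ∎
    where
    open ≤-Reasoning
    r : ℕ
    r = n / d
    regroup : ∀ r k → (r + r * 3) * k ≡ r * (4 * k)
    regroup = solve-∀
  n≤2dr : ∀ n → 1 ≤ n / d → n ≤ 2 * d * (n / d)
  n≤2dr n 1≤r = begin
    n                     ≡⟨ m≡m%n+[m/n]*n n d ⟩
    n % d + r * d         ≤⟨ +-monoˡ-≤ (r * d) (<⇒≤ (m%n<n n d)) ⟩
    d + r * d             ≡⟨ cong (_+ r * d) (*-identityʳ d) ⟨
    d * 1 + r * d         ≤⟨ +-monoˡ-≤ (r * d) (*-monoʳ-≤ d 1≤r) ⟩
    d * r + r * d         ≡⟨ regroup d r ⟩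
    2 * d * r             ∎
    where
    open ≤-Reasoning
    r : ℕ
    r = n / d
    regroup : ∀ d r → d * r + r * d ≡ 2 * d * r
    regroup = solve-∀
  growth : ∀ {n r} → R ≤ r → n ≤ 2 * d * r → c * (n * n * β ^ (r * 3)) ≤ suc β ^ (r * 3)
  growth {n} {r} R≤r n≤2dr = begin
    c * (n * n * β ^ (r * 3))                     ≤⟨ *-monoʳ-≤ c (*-monoˡ-≤ _ (*-mono-≤ n≤2dr n≤2dr)) ⟩
    c * (2 * d * r * (2 * d * r) * β ^ (r * 3))   ≡⟨ regroup c d r (β ^ (r * 3)) ⟩
    c′ * (r * r) * β ^ (r * 3)                    ≤⟨ cubic-below-exponential β c′ r R≤r ⟩
    suc β ^ (r * 3)                               ∎
    where
    open ≤-Reasoning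
    regroup : ∀ c d r x → c * (2 * d * r * (2 * d * r) * x) ≡ c * (2 * d) * (2 * d) * (r * r) * x
    regroup = solve-∀

-- Blocks and gadgets

module Blocks (k : ℕ) where

  at : ℕ → ℕ → ℕ
  at j i = i + j * suc k

  block : ℕ → ℕ
  block x = x / suc k

  block-at : ∀ j {i} → i ≤ k → block (at j i) ≡ j
  block-at j {i} i≤k = begin
    (i + j * suc k) / suc k         ≡⟨ +-distrib-/-∣ʳ i (n∣m*n j) ⟩
    i / suc k + j * suc k / suc k   ≡⟨ cong₂ _+_ (m<n⇒m/n≡0 (s≤s i≤k)) (m*n/n≡m j (suc k)) ⟩
    j                               ∎
    where open ≡-Reasoning

  -- The path a, at j 0, …, at j k, b through block j, each edge listed with an endpoint in block j first.
  gadgetEdges : ℕ → ℕ → ℕ → List (ℕ × ℕ)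
  gadgetEdges a b j = (at j 0 , a) ∷ (at j k , b) ∷ applyUpTo (λ i → at j i , at j (suc i)) k

  gadgetPositions : ℕ → ℕ → ℕ → List ℕ
  gadgetPositions a b j = map (uncurry pairIndex) (gadgetEdges a b j)

  length-gadgetPositions : ∀ a b j → length (gadgetPositions a b j) ≡ suc (suc k)
  length-gadgetPositions a b j =
    cong (suc ∘ suc) (trans (length-map (uncurry pairIndex) (applyUpTo _ k)) (length-applyUpTo _ k))

  module _ .{{_ : NonZero k}} where

    colour : ℕ → ℕ → Fin k
    colour x y = ((x ⊓ y) % suc k) mod k

    colour-step : ∀ j {i} → i < k → toℕ (colour (at j i) (at j (suc i))) ≡ i
    colour-step j {i} i<k = begin
      toℕ (colour (at j i) (at j (suc i)))  ≡⟨ toℕ-fromℕ< _ ⟩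
      ((at j i ⊓ at j (suc i)) % suc k) % k
        ≡⟨ cong (λ x → (x % suc k) % k) (m≤n⇒m⊓n≡m (+-monoˡ-≤ (j * suc k) (n≤1+n i))) ⟩
      (at j i % suc k) % k                  ≡⟨ cong (_% k) ([m+kn]%n≡m%n i j (suc k)) ⟩
      (i % suc k) % k                       ≡⟨ cong (_% k) (m<n⇒m%n≡m (m<n⇒m<1+n i<k)) ⟩
      i % k                                 ≡⟨ m<n⇒m%n≡m i<k ⟩
      i                                     ∎
      where open ≡-Reasoning

module Layout (k n B : ℕ) (blocks-fit : B * suc k ≤ n) where

  open Blocks k

  at<n : ∀ {j i} → j < B → i ≤ k → at j i < n
  at<n {j} j<B i≤k =
    <-≤-trans (+-monoˡ-< (j * suc k) (s≤s i≤k)) (≤-trans (*-monoˡ-≤ (suc k) j<B) blocks-fit)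

  Usable : ℕ → ℕ → ℕ → Set
  Usable a b j = j < B × block a ≢ j × block b ≢ j

  GadgetEdge : ℕ → ℕ → ℕ → ℕ × ℕ → Set
  GadgetEdge a b j (x , y) = x < n × y < n × x ≢ y × block x ≡ j × (block y ≡ j ⊎ y ≡ a ⊎ y ≡ b)

  gadgetEdges-wellFormed : ∀ {a b j} → a < n → b < n → Usable a b j →
                           All (GadgetEdge a b j) (gadgetEdges a b j)
  gadgetEdges-wellFormed {a} {b} {j} a<n b<n (j<B , ba≢j , bb≢j) =
    (at<n j<B z≤n , a<n , outside ba≢j z≤n , block-at j z≤n , inj₂ (inj₁ refl)) ∷
    (at<n j<B ≤-refl , b<n , outside bb≢j ≤-refl , block-at j ≤-refl , inj₂ (inj₂ refl)) ∷
    All.applyUpTo⁺₁ _ k (λ i<k →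
      at<n j<B (<⇒≤ i<k) , at<n j<B i<k , step-≢ , block-at j (<⇒≤ i<k) , inj₁ (block-at j i<k))
    where
    outside : ∀ {c i} → block c ≢ j → i ≤ k → at j i ≢ c
    outside bc≢j i≤k eq = bc≢j (trans (cong block (sym eq)) (block-at j i≤k))
    step-≢ : ∀ {i} → at j i ≢ at j (suc i)
    step-≢ {i} eq = 1+n≢n (sym (+-cancelʳ-≡ (j * suc k) i (suc i) eq))

  gadgetEdges-clash : ∀ {a b j j' x y x' y'} → Usable a b j → j ≢ j' →
    GadgetEdge a b j (x , y) → GadgetEdge a b j' (x' , y') → pairIndex x y ≢ pairIndex x' y'
  gadgetEdges-clash (_ , ba≢j , bb≢j) j≢j' (_ , _ , x≢y , bx , _) (_ , _ , x'≢y' , bx' , by') eq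
    with pairIndex-injective x≢y x'≢y' eq
  ... | inj₁ refl = j≢j' (trans (sym bx) bx')
  ... | inj₂ refl with by'
  ...   | inj₁ by'≡j'      = j≢j' (trans (sym bx) by'≡j')
  ...   | inj₂ (inj₁ refl) = ba≢j bx
  ...   | inj₂ (inj₂ refl) = bb≢j bx

  gadgets-disjoint : ∀ {a b j j'} → a < n → b < n → Usable a b j → Usable a b j' → j ≢ j' →
    (_∈ gadgetPositions a b j) ⊆ ∁ (_∈ gadgetPositions a b j')
  gadgets-disjoint a<n b<n uj uj' j≢j' p∈ p∈'
    with (x , y) , e∈ , p≡ ← ∈-map⁻ (uncurry pairIndex) p∈
       | (x' , y') , e∈' , p≡' ← ∈-map⁻ (uncurry pairIndex) p∈'
    = gadgetEdges-clash uj j≢j' (All.lookup (gadgetEdges-wellFormed a<n b<n uj) e∈)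
                                (All.lookup (gadgetEdges-wellFormed a<n b<n uj') e∈') (trans (sym p≡) p≡')

  gadgetPositions-bounded : ∀ {a b j} → a < n → b < n → Usable a b j →
                            All (_< tri n) (gadgetPositions a b j)
  gadgetPositions-bounded a<n b<n uj = All.map⁺ (All.map bounded (gadgetEdges-wellFormed a<n b<n uj))
    where
    bounded : ∀ {a b j e} → GadgetEdge a b j e → uncurry pairIndex e < tri n
    bounded {e = x , y} (x<n , y<n , x≢y , _) = pairIndex<tri x<n y<n x≢y

  usableBlocks : ℕ → ℕ → List ℕ
  usableBlocks a b = without (block b) (without (block a) (upTo B))

  usableBlocks-usable : ∀ a b → All (Usable a b) (usableBlocks a b)
  usableBlocks-usable a b = All.tabulate λ j∈ →
    let j∈' , j≢bb = ∈-filter⁻ (≢? (block b)) j∈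
        j∈″ , j≢ba = ∈-filter⁻ (≢? (block a)) j∈'
    in ∈-upTo⁻ j∈″ , j≢ba ∘ sym , j≢bb ∘ sym

  usableBlocks-unique : ∀ a b → Unique (usableBlocks a b)
  usableBlocks-unique a b = Unique.filter⁺ (≢? (block b)) (Unique.filter⁺ (≢? (block a)) (Unique.upTo⁺ B))

  length-usableBlocks : ∀ a b → B ∸ 2 ≤ length (usableBlocks a b)
  length-usableBlocks a b = m≤n+o⇒m∸n≤o B 2 (begin
    B                                          ≡⟨ length-upTo B ⟨
    length (upTo B)                            ≤⟨ length-without (block a) (Unique.upTo⁺ B) ⟩
    suc (length (without (block a) (upTo B)))
      ≤⟨ s≤s (length-without (block b) (Unique.filter⁺ (≢? (block a)) (Unique.upTo⁺ B))) ⟩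
    2 + length (usableBlocks a b)              ∎)
    where open ≤-Reasoning

  gadgetMissing : ℕ → ℕ → ℕ → Event
  gadgetMissing a b j w = not (allSet (gadgetPositions a b j) w)

  gadgetMissing-dependsOnly : ∀ a b j → DependsOnly (_∈ gadgetPositions a b j) (gadgetMissing a b j)
  gadgetMissing-dependsOnly a b j w w' agree = cong not (allSet-dependsOnly _ w w' agree)

  unlinked : ℕ → ℕ → Event
  unlinked a b = allOf (λ j → _∈ gadgetPositions a b j) (λ j → _∈? gadgetPositions a b j)
                       (gadgetMissing a b) (gadgetMissing-dependsOnly a b) (usableBlocks a b)

  count-unlinked : ∀ {a b} → a < n → b < n →
    count (tri n) (unlinked a b) * (2 ^ (2 + k)) ^ (B ∸ 2) ≤ (2 ^ (2 + k) ∸ 1) ^ (B ∸ 2) * 2 ^ tri n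
  count-unlinked {a} {b} a<n b<n =
    fewer-factors {x = count (tri n) (unlinked a b)} {{m^n≢0 2 (2 + k)}}
                  (m∸n≤m _ 1) (length-usableBlocks a b)
      (count-allOf-independent (λ j → _∈ gadgetPositions a b j) (λ j → _∈? gadgetPositions a b j)
        (gadgetMissing a b) (gadgetMissing-dependsOnly a b) (tri n) (usableBlocks a b)
        (allPairs-restrict (gadgets-disjoint a<n b<n) (usableBlocks-usable a b) (usableBlocks-unique a b))
        (All.map gadget-bound (usableBlocks-usable a b)))
    where
    gadget-bound : ∀ {j} → Usable a b j →
                   count (tri n) (gadgetMissing a b j) * 2 ^ (2 + k) ≤ (2 ^ (2 + k) ∸ 1) * 2 ^ tri n
    gadget-bound {j} uj =
      subst (λ L → count (tri n) (gadgetMissing a b j) * 2 ^ L ≤ (2 ^ L ∸ 1) * 2 ^ tri n)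
            (length-gadgetPositions a b j) (count-not-allSet (tri n) _ (gadgetPositions-bounded a<n b<n uj))

  someUnlinked : Event
  someUnlinked w = any (λ a → any (λ b → unlinked a b w) (upTo n)) (upTo n)

  count-someUnlinked : count (tri n) someUnlinked * (2 ^ (2 + k)) ^ (B ∸ 2) ≤
                       n * n * (2 ^ (2 + k) ∸ 1) ^ (B ∸ 2) * 2 ^ tri n
  count-someUnlinked = subst (count (tri n) someUnlinked * (2 ^ (2 + k)) ^ (B ∸ 2) ≤_) (regroup n _ _)
                             (over-vertices λ a<n → over-vertices λ b<n → count-unlinked a<n b<n)
    where
    regroup : ∀ n x y → n * (n * (x * y)) ≡ n * n * x * y
    regroup = solve-∀
    over-vertices : ∀ {E : ℕ → Event} {x y} → (∀ {a} → a < n → count (tri n) (E a) * x ≤ y) →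
                    count (tri n) (λ w → any (λ a → E a w) (upTo n)) * x ≤ n * y
    over-vertices {E} {x} {y} bound =
      subst (λ m → count (tri n) (λ w → any (λ a → E a w) (upTo n)) * x ≤ m * y) (length-upTo n)
            (count-any (tri n) E (upTo n) (All.applyUpTo⁺₁ _ n bound))

  module _ .{{_ : NonZero k}} .{{_ : NonZero n}} (w : List Bool) where

    colouring : EdgeColoring (toGraph n w) k
    colouring = record
      { col    = λ u v → colour (toℕ u) (toℕ v)
      ; colSym = λ u v → cong (λ x → (x % suc k) mod k) (⊓-comm (toℕ u) (toℕ v))
      }

    vertex : ℕ → Fin n
    vertex x = x mod n

    toℕ-vertex : ∀ {x} → x < n → toℕ (vertex x) ≡ x
    toℕ-vertex x<n = trans (toℕ-fromℕ< _) (m<n⇒m%n≡m x<n)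

    module _ {u v : Fin n} (u≢v : u ≢ v) {j} (usable : Usable (toℕ u) (toℕ v) j)
             (complete : T (allSet (gadgetPositions (toℕ u) (toℕ v) j) w)) where

      private
        G : Graph n
        G = toGraph n w
        a b : ℕ
        a = toℕ u
        b = toℕ v
        f : ℕ → Fin n
        f i = vertex (at j i)
        present : All (T ∘ bit w) (gadgetPositions a b j)
        present = All.all⁺ (bit w) _ complete

      toℕ-f : ∀ {i} → i ≤ k → toℕ (f i) ≡ at j i
      toℕ-f i≤k = toℕ-vertex (at<n (proj₁ usable) i≤k)

      gadget-adj : ∀ {p q x y} → (x , y) ∈ gadgetEdges a b j → toℕ p ≡ x → toℕ q ≡ y → adj G p q ≡ true
      gadget-adj e∈ p≡x q≡y =
        let _ , _ , x≢y , _ = All.lookup (gadgetEdges-wellFormed (toℕ<n u) (toℕ<n v) usable) e∈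
        in trans (toGraph-adj p≡x q≡y x≢y)
                 (Equivalence.to T-≡ (All.lookup present (∈-map⁺ (uncurry pairIndex) e∈)))

      gadget-steps : AdjacentUpTo {G = G} f k
      gadget-steps i<k = gadget-adj (there (there (∈-applyUpTo⁺ _ i<k))) (toℕ-f (<⇒≤ i<k)) (toℕ-f i<k)

      gadget-end : adj G (f k) v ≡ true
      gadget-end = gadget-adj (there (here refl)) (toℕ-f ≤-refl) refl

      linkingPath : Walk G u v
      linkingPath = trans (Graph.sym G u (f 0)) (gadget-adj (here refl) (toℕ-f z≤n) refl)
                  ∷ (walkAlong f k gadget-steps ▷ gadget-end)

      linkingPath-vertices : vertices linkingPath ≡ u ∷ applyUpTo f (suc k) ++ v ∷ []
      linkingPath-vertices = cong (u ∷_) (begin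
        vertices (walkAlong f k gadget-steps ▷ gadget-end)
          ≡⟨ vertices-▷ (walkAlong f k gadget-steps) gadget-end ⟩
        vertices (walkAlong f k gadget-steps) ++ v ∷ []
          ≡⟨ cong (_++ v ∷ []) (vertices-walkAlong f k gadget-steps) ⟩
        applyUpTo f (suc k) ++ v ∷ [] ∎)
        where open ≡-Reasoning

      f-outside : ∀ {c i} → block (toℕ c) ≢ j → i ≤ k → c ≢ f i
      f-outside {i = i} bc≢j i≤k c≡fi =
        bc≢j (trans (cong block (trans (cong toℕ c≡fi) (toℕ-f i≤k))) (block-at j i≤k))

      f-injective : ∀ {i i'} → i < i' → i' < suc k → f i ≢ f i'
      f-injective {i} {i'} i<i' (s≤s i'≤k) fi≡fi' = <⇒≢ i<i' (+-cancelʳ-≡ (j * suc k) i i' (begin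
        at j i        ≡⟨ toℕ-f (≤-trans (<⇒≤ i<i') i'≤k) ⟨
        toℕ (f i)     ≡⟨ cong toℕ fi≡fi' ⟩
        toℕ (f i')    ≡⟨ toℕ-f i'≤k ⟩
        at j i'       ∎))
        where open ≡-Reasoning

      linkingPath-isPath : IsPath linkingPath
      linkingPath-isPath = subst Unique (sym linkingPath-vertices)
        ( All.++⁺ (All.applyUpTo⁺₁ f (suc k) λ { (s≤s i≤k) → f-outside u-outside i≤k }) (u≢v ∷ [])
        ∷ AllPairs.++⁺ (Unique.applyUpTo⁺₁ f (suc k) f-injective) ([] ∷ [])
            (All.applyUpTo⁺₁ f (suc k) λ { (s≤s i≤k) → (f-outside v-outside i≤k ∘ sym) ∷ [] }))
        where
        u-outside : block a ≢ j
        u-outside = proj₁ (proj₂ usable)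
        v-outside : block b ≢ j
        v-outside = proj₂ (proj₂ usable)

      linkingPath-colours : edgeColors colouring linkingPath ≡
        colour a (toℕ (f 0)) ∷ applyUpTo (λ i → colour (toℕ (f i)) (toℕ (f (suc i)))) k
                             ++ colour (toℕ (f k)) b ∷ []
      linkingPath-colours = cong (_ ∷_) (begin
        edgeColors colouring (walkAlong f k gadget-steps ▷ gadget-end)
          ≡⟨ edgeColors-▷ colouring (walkAlong f k gadget-steps) gadget-end ⟩
        edgeColors colouring (walkAlong f k gadget-steps) ++ _
          ≡⟨ cong (_++ colour (toℕ (f k)) b ∷ []) (edgeColors-walkAlong colouring f k gadget-steps) ⟩
        applyUpTo (λ i → colour (toℕ (f i)) (toℕ (f (suc i)))) k ++ _ ∎)
        where open ≡-Reasoning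

      linkingPath-rainbow : UsesAtLeastColors colouring k linkingPath
      linkingPath-rainbow = allFin k , Unique.allFin⁺ k , length-tabulate id , All.universal occurs (allFin k)
        where
        step-colour : (c : Fin k) → colour (toℕ (f (toℕ c))) (toℕ (f (suc (toℕ c)))) ≡ c
        step-colour c = toℕ-injective (begin
          toℕ (colour (toℕ (f (toℕ c))) (toℕ (f (suc (toℕ c)))))
            ≡⟨ cong₂ (λ x y → toℕ (colour x y)) (toℕ-f (<⇒≤ (toℕ<n c))) (toℕ-f (toℕ<n c)) ⟩
          toℕ (colour (at j (toℕ c)) (at j (suc (toℕ c))))
            ≡⟨ colour-step j (toℕ<n c) ⟩
          toℕ c ∎)
          where open ≡-Reasoning
        occurs : (c : Fin k) → c ∈ edgeColors colouring linkingPath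
        occurs c = subst (c ∈_) (sym linkingPath-colours)
          (there (∈-++⁺ˡ (subst (_∈ applyUpTo _ k) (step-colour c) (∈-applyUpTo⁺ _ (toℕ<n c)))))

    toGraph-ccIs : 2 ≤ n → T (not (someUnlinked w)) → ccIs k (toGraph n w) k
    toGraph-ccIs 2≤n linked = (colouring , connecting) , λ r r<k kcc → <⇒≱ r<k (hasKCC⇒k≤r 2≤n kcc)
      where
      pair-linked : ∀ {a b} → a < n → b < n → T (not (unlinked a b w))
      pair-linked a<n b<n =
        none-satisfied (λ b → unlinked _ b w) (∈-upTo⁺ b<n)
          (none-satisfied (λ a → any (λ b → unlinked a b w) (upTo n)) (∈-upTo⁺ a<n) linked)
      connecting : KColorConnecting k colouring
      connecting u v u≢v
        with usable , complete ← All.lookupAny (usableBlocks-usable (toℕ u) (toℕ v))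
               (some-satisfied (λ j → allSet (gadgetPositions (toℕ u) (toℕ v) j) w) _
                               (pair-linked (toℕ<n u) (toℕ<n v)))
        = linkingPath u≢v usable complete ,
          linkingPath-isPath u≢v usable complete ,
          linkingPath-rainbow u≢v usable complete

  module _ .{{_ : NonZero k}} .{{_ : NonZero n}} where

    wellLinked : List (Graph n)
    wellLinked = map (toGraph n) (satisfying (tri n) (not ∘ someUnlinked))

    wellLinked-distinct : AllPairs Distinct wellLinked
    wellLinked-distinct = AllPairs.map⁺ (AllPairs.map toGraph-distinct (satisfying-distinct (tri n) _))

    wellLinked-ccIs : 2 ≤ n → All (λ G → ccIs k G k) wellLinked
    wellLinked-ccIs 2≤n = All.map⁺ (All.map (λ {w} → toGraph-ccIs w 2≤n) (satisfying-sound (tri n) _))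

    wellLinked-proportion : ∀ m → m * (n * n * (2 ^ (2 + k) ∸ 1) ^ (B ∸ 2)) ≤ (2 ^ (2 + k)) ^ (B ∸ 2) →
                            (m ∸ 1) * numGraphs n ≤ m * length wellLinked
    wellLinked-proportion m small =
      subst (λ P → (m ∸ 1) * P ≤ m * length wellLinked) (cong (2 ^_) (tri≡C2 n))
            (proportion-bound {X = count (tri n) someUnlinked} {Z = n * n * (2 ^ (2 + k) ∸ 1) ^ (B ∸ 2)} {m = m}
                              {{m^n≢0 (2 ^ (2 + k)) (B ∸ 2) {{m^n≢0 2 (2 + k)}}}} total count-someUnlinked small)
      where
      total : count (tri n) someUnlinked + length wellLinked ≡ 2 ^ tri n
      total = trans (cong (count (tri n) someUnlinked +_)
                          (trans (length-map (toGraph n) (satisfying (tri n) (not ∘ someUnlinked)))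
                                 (length-satisfying (tri n) _)))
                    (count-complement (tri n) someUnlinked)

ccIs-proportion : ∀ k .{{_ : NonZero k}} m n T → (2 + T) * suc k ≤ n →
  m * (n * n * (2 ^ (2 + k) ∸ 1) ^ T) ≤ (2 ^ (2 + k)) ^ T →
  Σ (List (Graph n)) λ L → AllPairs Distinct L × All (λ G → ccIs k G k) L ×
                           (m ∸ 1) * numGraphs n ≤ m * length L
ccIs-proportion k m n T fits small =
  wellLinked , wellLinked-distinct , wellLinked-ccIs 2≤n , wellLinked-proportion m small
  where
  2≤n : 2 ≤ n
  2≤n = ≤-trans (m≤m+n 2 T) (≤-trans (m≤m*n (2 + T) (suc k)) fits)
  instance
    n≢0 : NonZero n
    n≢0 = >-nonZero (≤-trans (s≤s z≤n) 2≤n)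
  open Layout k n (2 + T) fits

theorem3p7 : (k : ℕ) → 2 ≤ k →
    (m : ℕ) → 1 ≤ m →
    ∃[ N ] ((n : ℕ) → N ≤ n →
      Σ (List (Graph n)) λ L → (AllPairs Distinct L × All (λ G → ccIs k G k) L
             × (m ∸ 1) * numGraphs n ≤ m * length L))
theorem3p7 k@(suc _) _ m _ = proj₁ (enough-blocks k (A ∸ 1) m) , λ n N₀≤n →
  let T , fits , small = proj₂ (enough-blocks k (A ∸ 1) m) n N₀≤n
  in ccIs-proportion k m n T fits (subst (λ A → m * (n * n * (A ∸ 1) ^ T) ≤ A ^ T) suc[A∸1]≡A small)
  where
  A : ℕ
  A = 2 ^ (2 + k)
  instance
    A∸1≢0 : NonZero (A ∸ 1)
    A∸1≢0 = >-nonZero (≤-trans (s≤s z≤n) (∸-monoˡ-≤ 1 (^-monoʳ-≤ 2 (m≤m+n 2 k))))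
  suc[A∸1]≡A : suc (A ∸ 1) ≡ A
  suc[A∸1]≡A = suc-pred A {{m^n≢0 2 (2 + k)}}
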